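{- Let $m$ be a positive integer and $\lambda$ a nonzero real number. Then, as formal power series in $t$, $$e_{\lambda}(t)\,e^{x\left(\frac{e_{\lambda}^{m}(t)-1}{m}\right)}=\sum_{n=0}^{\infty}D_{m,\lambda}(n,x)\frac{t^{n}}{n!}.$$
   Context: For a nonzero real $\lambda$: $(x)_{0,\lambda}=1$, $(x)_{n,\lambda}=x(x-\lambda)\cdots(x-(n-1)\lambda)$ for $n\ge1$; $(x)_n=(x)_{n,1}$. The degenerate exponential is $e_\lambda^x(t)=(1+\lambda t)^{x/\lambda}=\sum_{n\ge0}(x)_{n,\lambda}t^n/n!$, $e_\lambda(t)=e_\lambda^1(t)$. The degenerate Whitney numbers of the second kind $W_{m,\lambda}(n,k)$ are defined by $(mx+1)_{n,\lambda}=\sum_{k=0}^{n}W_{m,\lambda}(n,k)m^{k}(x)_{k}$ ($n\ge0$), and the degenerate Dowling polynomials are $D_{m,\lambda}(n,x)=\sum_{k=0}^{n}W_{m,\lambda}(n,k)x^{k}$. -}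

module Defs where

open import Level using (Level; suc; _⊔_)
open import Data.Nat as ℕ using (ℕ; zero; _∸_)
open import Relation.Nullary using (¬_)
open import Algebra.Bundles using (CommutativeRing)

-- A field of characteristic zero, presented as a commutative ring together
-- with a (total) reciprocal function that is a genuine inverse on nonzero
-- elements, and the characteristic-zero axiom.  (The paper works over ℝ,
-- which is an instance; agda-stdlib has neither ℝ nor a Field bundle.)
-- canonical image of a natural number in a ring: n ↦ 1 + 1 + ... + 1
natCast : ∀ {c ℓ} (R : CommutativeRing c ℓ) → ℕ → CommutativeRing.Carrier R
natCast R zero = CommutativeRing.0# R
natCast R (ℕ.suc n) = CommutativeRing._+_ R (CommutativeRing.1# R) (natCast R n)

record CharZeroField (c ℓ : Level) : Set (Level.suc (c ⊔ ℓ)) where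
  field
    commRing : CommutativeRing c ℓ
  open CommutativeRing commRing public
  ι : ℕ → Carrier
  ι = natCast commRing
  field
    inv       : Carrier → Carrier
    inv-cong  : ∀ {x y} → x ≈ y → inv x ≈ inv y
    inv-right : ∀ x → ¬ (x ≈ 0#) → x * inv x ≈ 1#
    charZero  : ∀ n → ¬ (ι (ℕ.suc n) ≈ 0#)

module FieldDefs {c ℓ} (F : CharZeroField c ℓ) where
  open CharZeroField F

  pow : Carrier → ℕ → Carrier
  pow x zero = 1#
  pow x (ℕ.suc k) = pow x k * x

  sumTo : ℕ → (ℕ → Carrier) → Carrier
  sumTo zero f = f 0
  sumTo (ℕ.suc n) f = sumTo n f + f (ℕ.suc n)

  fact : ℕ → Carrier
  fact n = ι (n ℕ.!)

  dfall : Carrier → Carrier → ℕ → Carrier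
  dfall lam x zero = 1#
  dfall lam x (ℕ.suc n) = dfall lam x n * (x - ι n * lam)

  fall : Carrier → ℕ → Carrier
  fall x n = dfall 1# x n

  Series : Set c
  Series = ℕ → Carrier

  _≈ₛ_ : Series → Series → Set ℓ
  f ≈ₛ g = ∀ n → f n ≈ g n

  _*ₛ_ : Series → Series → Series
  (f *ₛ g) n = sumTo n (λ i → f i * g (n ∸ i))

  _-ₛ_ : Series → Series → Series
  (f -ₛ g) n = f n - g n

  scaleₛ : Carrier → Series → Series
  scaleₛ a f n = a * f n

  oneₛ : Series
  oneₛ zero = 1#
  oneₛ (ℕ.suc n) = 0#

  powₛ : Series → ℕ → Series
  powₛ g zero = oneₛ
  powₛ g (ℕ.suc k) = powₛ g k *ₛ g

  -- exp(g) = Σ_k g^k / k!  for a series g with zero constant term;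
  -- then only k ≤ n contributes to the coefficient of t^n.
  expₛ : Series → Series
  expₛ g n = sumTo n (λ k → powₛ g k n * inv (fact k))

  eλ^ : Carrier → Carrier → Series
  eλ^ lam x n = dfall lam x n * inv (fact n)

  eλ : Carrier → Series
  eλ lam = eλ^ lam 1#

  -- W is (a choice of) the degenerate Whitney numbers of the second kind:
  -- (m y + 1)_{n,λ} = Σ_{k=0}^{n} W(n,k) m^k (y)_k  for all n and all y
  IsDegWhitney2 : ℕ → Carrier → (ℕ → ℕ → Carrier) → Set (c ⊔ ℓ)
  IsDegWhitney2 m lam W =
    ∀ n y → dfall lam (ι m * y + 1#) n
              ≈ sumTo n (λ k → W n k * pow (ι m) k * fall y k)

  dowling : (ℕ → ℕ → Carrier) → ℕ → Carrier → Carrier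
  dowling W n x = sumTo n (λ k → W n k * pow x k)

-- Expanding the exponential, the coefficient of tⁿ on the left is
-- Σₖ (x/m)ᵏ/k! · [tⁿ] e_λ(t) G(t)ᵏ with G = e_λ^m(t) − 1, so it suffices to show
-- mᵏ W(n,k) = (n!/k!) [tⁿ] e_λ Gᵏ.  Both families solve the same triangular
-- system in the falling-factorial basis: at y = j ∈ ℕ the defining relation gives
-- (mj + 1)_{n,λ}, while Σₖ (j)ₖ/k! Gᵏ = (1 + G)ʲ = e_λ^{jm} and
-- e_λ · e_λ^{jm} = e_λ^{1+jm}.  This addition law holds because both sides satisfy
-- the recurrence (n+1) eₙ₊₁ = (a − nλ) eₙ characterising e_λ^a.  As (j)ₖ = 0 for
-- k > j and (j)ⱼ = j! ≠ 0, the values at j = 0, …, n determine the coefficients.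
module Submission where

open import Defs
open import Data.Nat as ℕ using (ℕ; zero; suc; _∸_; _!; _≤_; _<_; _≥_; z≤n; s≤s; _≤′_; ≤′-refl; ≤′-step)
import Data.Nat.Properties as ℕ
open import Data.Nat.Induction using (<-rec)
open import Data.Maybe using (Maybe; just; nothing)
open import Relation.Nullary using (¬_; yes; no; contradiction)
open import Relation.Binary.Definitions using (tri<; tri≈; tri>)
open import Relation.Binary.PropositionalEquality as ≡ using (_≡_; _≢_)
import Algebra.Properties.Ring
import Algebra.Properties.Semiring.Mult
import Algebra.Solver.Ring.NaturalCoefficients
import Relation.Binary.Reasoning.Setoid

module Theory {c ℓ} (F : CharZeroField c ℓ) where
  open CharZeroField F hiding (zero)
  open FieldDefs F
  open Algebra.Properties.Ring ring
  open Algebra.Properties.Semiring.Mult semiring using (_×_; ×-homo-+; ×1-homo-*)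
  open Relation.Binary.Reasoning.Setoid setoid

  coefficient≟ : ∀ a b → Maybe (a × 1# ≈ b × 1#)
  coefficient≟ a b with a ℕ.≟ b
  ... | yes ≡.refl = just refl
  ... | no _ = nothing

  open Algebra.Solver.Ring.NaturalCoefficients commutativeSemiring coefficient≟

  -- Arithmetic in the field

  ι≡×1 : ∀ n → ι n ≡ n × 1#
  ι≡×1 zero = ≡.refl
  ι≡×1 (suc n) = ≡.cong (1# +_) (ι≡×1 n)

  ι-homo-+ : ∀ a b → ι (a ℕ.+ b) ≈ ι a + ι b
  ι-homo-+ a b rewrite ι≡×1 (a ℕ.+ b) | ι≡×1 a | ι≡×1 b = ×-homo-+ 1# a b

  ι-homo-* : ∀ a b → ι (a ℕ.* b) ≈ ι a * ι b
  ι-homo-* a b rewrite ι≡×1 (a ℕ.* b) | ι≡×1 a | ι≡×1 b = ×1-homo-* a b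

  ι-split : ∀ {i n} → i ≤ n → ι i + ι (n ∸ i) ≈ ι n
  ι-split {i} {n} i≤n = trans (sym (ι-homo-+ i (n ∸ i))) (reflexive (≡.cong ι (ℕ.m+[n∸m]≡n i≤n)))

  -‿interchange : ∀ a b x y → (a - x) + (b - y) ≈ (a + b) - (x + y)
  -‿interchange a b x y = begin
    (a + - x) + (b + - y)
      ≈⟨ solve 4 (λ a b x′ y′ → (a :+ x′) :+ (b :+ y′) := (a :+ b) :+ (x′ :+ y′)) refl a b (- x) (- y) ⟩
    (a + b) + (- x + - y)  ≈⟨ +-congˡ (-‿+-comm x y) ⟩
    (a + b) - (x + y)      ∎

  +-sub-+ : ∀ a x y → (a + x) - (a + y) ≈ x - y
  +-sub-+ a x y = begin
    (a + x) - (a + y)  ≈⟨ -‿interchange a x a y ⟨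
    (a - a) + (x - y)  ≈⟨ +-congʳ (-‿inverseʳ a) ⟩
    0# + (x - y)       ≈⟨ +-identityˡ _ ⟩
    x - y              ∎

  x+[y-x]≈y : ∀ x y → x + (y - x) ≈ y
  x+[y-x]≈y x y = trans (sym (+-assoc x y (- x))) (xyx⁻¹≈y x y)

  inv-*-cancel : ∀ {a} → ¬ a ≈ 0# → ∀ u → inv a * (a * u) ≈ u
  inv-*-cancel {a} a≉0 u = begin
    inv a * (a * u)  ≈⟨ solve 3 (λ a b u → b :* (a :* u) := (a :* b) :* u) refl a (inv a) u ⟩
    (a * inv a) * u  ≈⟨ *-congʳ (inv-right a a≉0) ⟩
    1# * u           ≈⟨ *-identityˡ u ⟩
    u                ∎

  *-cancelˡ : ∀ {a u v} → ¬ a ≈ 0# → a * u ≈ a * v → u ≈ v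
  *-cancelˡ {a} {u} {v} a≉0 au≈av = begin
    u                ≈⟨ inv-*-cancel a≉0 u ⟨
    inv a * (a * u)  ≈⟨ *-congˡ au≈av ⟩
    inv a * (a * v)  ≈⟨ inv-*-cancel a≉0 v ⟩
    v                ∎

  *-≉0 : ∀ {a b} → ¬ a ≈ 0# → ¬ b ≈ 0# → ¬ a * b ≈ 0#
  *-≉0 {a} {b} a≉0 b≉0 ab≈0 = b≉0 (begin
    b                ≈⟨ inv-*-cancel a≉0 b ⟨
    inv a * (a * b)  ≈⟨ *-congˡ ab≈0 ⟩
    inv a * 0#       ≈⟨ zeroʳ _ ⟩
    0#               ∎)

  fact-suc : ∀ n → fact (suc n) ≈ ι (suc n) * fact n
  fact-suc n = ι-homo-* (suc n) (n !)

  fact≉0 : ∀ n → ¬ fact n ≈ 0#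
  fact≉0 zero = charZero 0
  fact≉0 (suc n) eq = *-≉0 (charZero n) (fact≉0 n) (trans (sym (fact-suc n)) eq)

  fact-inv : ∀ n → fact n * inv (fact n) ≈ 1#
  fact-inv n = inv-right (fact n) (fact≉0 n)

  inv-fact-0 : inv (fact 0) ≈ 1#
  inv-fact-0 = *-cancelˡ (fact≉0 0) (trans (fact-inv 0) (sym (trans (*-identityʳ _) (+-identityʳ 1#))))

  ι[1+n]*inv-fact : ∀ n → ι (suc n) * inv (fact (suc n)) ≈ inv (fact n)
  ι[1+n]*inv-fact n = *-cancelˡ (fact≉0 n) (begin
    fact n * (ι (suc n) * inv (fact (suc n)))
      ≈⟨ solve 3 (λ f i j → f :* (i :* j) := (i :* f) :* j) refl (fact n) (ι (suc n)) _ ⟩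
    (ι (suc n) * fact n) * inv (fact (suc n))  ≈⟨ *-congʳ (fact-suc n) ⟨
    fact (suc n) * inv (fact (suc n))          ≈⟨ fact-inv (suc n) ⟩
    1#                                         ≈⟨ fact-inv n ⟨
    fact n * inv (fact n)                      ∎)

  pow-homo-* : ∀ a b k → pow (a * b) k ≈ pow a k * pow b k
  pow-homo-* a b zero = sym (*-identityˡ 1#)
  pow-homo-* a b (suc k) = trans (*-congʳ (pow-homo-* a b k))
    (solve 4 (λ p q a b → (p :* q) :* (a :* b) := (p :* a) :* (q :* b)) refl _ _ a b)

  pow-inv : ∀ {a} → ¬ a ≈ 0# → ∀ k → pow (inv a) k * pow a k ≈ 1#
  pow-inv a≉0 zero = *-identityˡ 1#
  pow-inv {a} a≉0 (suc k) = begin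
    (pow (inv a) k * inv a) * (pow a k * a)
      ≈⟨ solve 4 (λ p b q a → (p :* b) :* (q :* a) := (p :* q) :* (a :* b)) refl _ (inv a) _ a ⟩
    (pow (inv a) k * pow a k) * (a * inv a)  ≈⟨ *-cong (pow-inv a≉0 k) (inv-right a a≉0) ⟩
    1# * 1#                                  ≈⟨ *-identityˡ 1# ⟩
    1#                                       ∎

  -- Finite sums

  sumTo-cong : ∀ n {f g : ℕ → Carrier} → (∀ i → i ≤ n → f i ≈ g i) → sumTo n f ≈ sumTo n g
  sumTo-cong zero f≈g = f≈g 0 z≤n
  sumTo-cong (suc n) f≈g =
    +-cong (sumTo-cong n (λ i i≤n → f≈g i (ℕ.m≤n⇒m≤1+n i≤n))) (f≈g (suc n) ℕ.≤-refl)

  sumTo-+ : ∀ n (f g : ℕ → Carrier) → sumTo n (λ i → f i + g i) ≈ sumTo n f + sumTo n g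
  sumTo-+ zero f g = refl
  sumTo-+ (suc n) f g = trans (+-congʳ (sumTo-+ n f g))
    (solve 4 (λ a b c d → (a :+ b) :+ (c :+ d) := (a :+ c) :+ (b :+ d)) refl _ _ _ _)

  sumTo-sub : ∀ n (f g : ℕ → Carrier) → sumTo n (λ i → f i - g i) ≈ sumTo n f - sumTo n g
  sumTo-sub zero f g = refl
  sumTo-sub (suc n) f g = trans (+-congʳ (sumTo-sub n f g)) (-‿interchange _ _ _ _)

  *-distribˡ-sumTo : ∀ n a (f : ℕ → Carrier) → a * sumTo n f ≈ sumTo n (λ i → a * f i)
  *-distribˡ-sumTo zero a f = refl
  *-distribˡ-sumTo (suc n) a f = trans (distribˡ _ _ _) (+-congʳ (*-distribˡ-sumTo n a f))

  *-distribʳ-sumTo : ∀ n a (f : ℕ → Carrier) → sumTo n f * a ≈ sumTo n (λ i → f i * a)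
  *-distribʳ-sumTo n a f =
    trans (*-comm _ _) (trans (*-distribˡ-sumTo n a f) (sumTo-cong n (λ i _ → *-comm a (f i))))

  sumTo-suc : ∀ n (f : ℕ → Carrier) → sumTo (suc n) f ≈ f 0 + sumTo n (λ i → f (suc i))
  sumTo-suc zero f = refl
  sumTo-suc (suc n) f = trans (+-congʳ (sumTo-suc n f)) (+-assoc _ _ _)

  sumTo-comm : ∀ n N (f : ℕ → ℕ → Carrier) →
    sumTo n (λ i → sumTo N (f i)) ≈ sumTo N (λ k → sumTo n (λ i → f i k))
  sumTo-comm zero N f = refl
  sumTo-comm (suc n) N f = trans (+-congʳ (sumTo-comm n N f))
    (sym (sumTo-+ N (λ k → sumTo n (λ i → f i k)) (f (suc n))))

  sumTo-extend : ∀ {n N} {f : ℕ → Carrier} → n ≤ N → (∀ k → n < k → k ≤ N → f k ≈ 0#) →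
    sumTo N f ≈ sumTo n f
  sumTo-extend n≤N = extend (ℕ.≤⇒≤′ n≤N)
    where
    extend : ∀ {n N} {f : ℕ → Carrier} → n ≤′ N → (∀ k → n < k → k ≤ N → f k ≈ 0#) →
      sumTo N f ≈ sumTo n f
    extend ≤′-refl _ = refl
    extend (≤′-step n≤′N) f≈0 = trans
      (+-cong (extend n≤′N (λ k n<k k≤N → f≈0 k n<k (ℕ.m≤n⇒m≤1+n k≤N)))
              (f≈0 _ (s≤s (ℕ.≤′⇒≤ n≤′N)) ℕ.≤-refl))
      (+-identityʳ _)

  sumTo-zero : ∀ n {f : ℕ → Carrier} → (∀ i → i ≤ n → f i ≈ 0#) → sumTo n f ≈ 0#
  sumTo-zero n f≈0 = trans (sumTo-extend z≤n (λ k _ k≤n → f≈0 k k≤n)) (f≈0 0 z≤n)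

  sumTo-single : ∀ {n j} {f : ℕ → Carrier} → j ≤ n → (∀ k → k ≤ n → k ≢ j → f k ≈ 0#) →
    sumTo n f ≈ f j
  sumTo-single {zero} z≤n _ = refl
  sumTo-single {suc n} {j} j≤1+n f≈0 with j ℕ.≟ suc n
  ... | yes ≡.refl = trans
    (+-congʳ (sumTo-zero n (λ k k≤n → f≈0 k (ℕ.m≤n⇒m≤1+n k≤n) (ℕ.<⇒≢ (s≤s k≤n)))))
    (+-identityˡ _)
  ... | no j≢1+n = trans
    (+-cong (sumTo-single (ℕ.≤-pred (ℕ.≤∧≢⇒< j≤1+n j≢1+n)) (λ k k≤n → f≈0 k (ℕ.m≤n⇒m≤1+n k≤n)))
            (f≈0 (suc n) ℕ.≤-refl (≡.≢-sym j≢1+n)))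
    (+-identityʳ _)

  -- Formal power series

  _+ₛ_ : Series → Series → Series
  (f +ₛ g) n = f n + g n

  ∂ₛ : Series → Series
  ∂ₛ f n = ι (suc n) * f (suc n)

  *ₛ-cong : ∀ {f f′ g g′ : Series} → f ≈ₛ f′ → g ≈ₛ g′ → (f *ₛ g) ≈ₛ (f′ *ₛ g′)
  *ₛ-cong f≈f′ g≈g′ n = sumTo-cong n (λ i _ → *-cong (f≈f′ i) (g≈g′ (n ∸ i)))

  *ₛ-congˡ : ∀ {f f′ : Series} (g : Series) → f ≈ₛ f′ → (f *ₛ g) ≈ₛ (f′ *ₛ g)
  *ₛ-congˡ g f≈f′ = *ₛ-cong {g = g} {g′ = g} f≈f′ (λ _ → refl)

  *ₛ-congʳ-≤ : ∀ n (f : Series) {g g′ : Series} → (∀ d → d ≤ n → g d ≈ g′ d) →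
    (f *ₛ g) n ≈ (f *ₛ g′) n
  *ₛ-congʳ-≤ n f g≈g′ = sumTo-cong n (λ i _ → *-congˡ (g≈g′ (n ∸ i) (ℕ.m∸n≤m n i)))

  *ₛ-congʳ : ∀ (f : Series) {g g′ : Series} → g ≈ₛ g′ → (f *ₛ g) ≈ₛ (f *ₛ g′)
  *ₛ-congʳ f g≈g′ n = *ₛ-congʳ-≤ n f (λ d _ → g≈g′ d)

  *ₛ-+ₛʳ : ∀ (f g h : Series) n → (f *ₛ (g +ₛ h)) n ≈ (f *ₛ g) n + (f *ₛ h) n
  *ₛ-+ₛʳ f g h n = trans (sumTo-cong n (λ i _ → distribˡ _ _ _)) (sumTo-+ n _ _)

  oneₛ-≢0 : ∀ {d} → d ≢ 0 → oneₛ d ≈ 0#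
  oneₛ-≢0 {zero} d≢0 = contradiction ≡.refl d≢0
  oneₛ-≢0 {suc d} _ = refl

  *ₛ-oneₛʳ : ∀ (f : Series) n → (f *ₛ oneₛ) n ≈ f n
  *ₛ-oneₛʳ f n = trans (sumTo-single ℕ.≤-refl off-diagonal) diagonal
    where
    off-diagonal : ∀ k → k ≤ n → k ≢ n → f k * oneₛ (n ∸ k) ≈ 0#
    off-diagonal k k≤n k≢n =
      trans (*-congˡ (oneₛ-≢0 (λ n∸k≡0 → k≢n (ℕ.≤-antisym k≤n (ℕ.m∸n≡0⇒m≤n n∸k≡0))))) (zeroʳ _)
    diagonal : f n * oneₛ (n ∸ n) ≈ f n
    diagonal rewrite ℕ.n∸n≡0 n = *-identityʳ (f n)

  *ₛ-sumʳ : ∀ N (a : ℕ → Carrier) (f : Series) (g : ℕ → Series) n →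
    (f *ₛ (λ d → sumTo N (λ k → a k * g k d))) n ≈ sumTo N (λ k → a k * (f *ₛ g k) n)
  *ₛ-sumʳ N a f g n = begin
    sumTo n (λ i → f i * sumTo N (λ k → a k * g k (n ∸ i)))
      ≈⟨ sumTo-cong n (λ i _ → trans (*-distribˡ-sumTo N _ _) (sumTo-cong N (λ k _ →
           solve 3 (λ f a g → f :* (a :* g) := a :* (f :* g)) refl _ _ _))) ⟩
    sumTo n (λ i → sumTo N (λ k → a k * (f i * g k (n ∸ i))))
      ≈⟨ sumTo-comm n N _ ⟩
    sumTo N (λ k → sumTo n (λ i → a k * (f i * g k (n ∸ i))))
      ≈⟨ sumTo-cong N (λ k _ → *-distribˡ-sumTo n _ _) ⟨
    sumTo N (λ k → a k * (f *ₛ g k) n) ∎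

  *ₛ-sumˡ : ∀ N (a : ℕ → Carrier) (g : ℕ → Series) (f : Series) n →
    ((λ d → sumTo N (λ k → a k * g k d)) *ₛ f) n ≈ sumTo N (λ k → a k * (g k *ₛ f) n)
  *ₛ-sumˡ N a g f n = begin
    sumTo n (λ i → sumTo N (λ k → a k * g k i) * f (n ∸ i))
      ≈⟨ sumTo-cong n (λ i _ → trans (*-distribʳ-sumTo N _ _) (sumTo-cong N (λ k _ → *-assoc _ _ _))) ⟩
    sumTo n (λ i → sumTo N (λ k → a k * (g k i * f (n ∸ i))))
      ≈⟨ sumTo-comm n N _ ⟩
    sumTo N (λ k → sumTo n (λ i → a k * (g k i * f (n ∸ i))))
      ≈⟨ sumTo-cong N (λ k _ → *-distribˡ-sumTo n _ _) ⟨
    sumTo N (λ k → a k * (g k *ₛ f) n) ∎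

  *ₛ-vanish : ∀ (f g : Series) {n} → (∀ d → d ≤ n → g d ≈ 0#) → (f *ₛ g) n ≈ 0#
  *ₛ-vanish f g {n} g≈0 = sumTo-zero n (λ i _ → trans (*-congˡ (g≈0 (n ∸ i) (ℕ.m∸n≤m n i))) (zeroʳ _))

  powₛ-cong : ∀ {f g : Series} → f ≈ₛ g → ∀ k → powₛ f k ≈ₛ powₛ g k
  powₛ-cong f≈g zero n = refl
  powₛ-cong f≈g (suc k) = *ₛ-cong (powₛ-cong f≈g k) f≈g

  powₛ-scaleₛ : ∀ a (g : Series) k → powₛ (scaleₛ a g) k ≈ₛ scaleₛ (pow a k) (powₛ g k)
  powₛ-scaleₛ a g zero n = sym (*-identityˡ _)
  powₛ-scaleₛ a g (suc k) n = trans
    (sumTo-cong n (λ i _ → trans (*-congʳ (powₛ-scaleₛ a g k i))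
      (solve 4 (λ p q b r → (p :* q) :* (b :* r) := (p :* b) :* (q :* r)) refl _ _ _ _)))
    (sym (*-distribˡ-sumTo n _ _))

  powₛ-vanish : ∀ {g : Series} → g 0 ≈ 0# → ∀ {k d} → d < k → powₛ g k d ≈ 0#
  powₛ-vanish {g} g0≈0 {suc k} {d} (s≤s d≤k) = sumTo-zero d term
    where
    term : ∀ i → i ≤ d → powₛ g k i * g (d ∸ i) ≈ 0#
    term i i≤d with i ℕ.<? k
    ... | yes i<k = trans (*-congʳ (powₛ-vanish g0≈0 i<k)) (zeroˡ _)
    ... | no i≮k rewrite ℕ.m≤n⇒m∸n≡0 (ℕ.≤-trans d≤k (ℕ.≮⇒≥ i≮k)) = trans (*-congˡ g0≈0) (zeroʳ _)

  expₛ-scaleₛ : ∀ a {g : Series} → g 0 ≈ 0# → ∀ {d N} → d ≤ N →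
    expₛ (scaleₛ a g) d ≈ sumTo N (λ k → (pow a k * inv (fact k)) * powₛ g k d)
  expₛ-scaleₛ a {g} g0≈0 {d} {N} d≤N = begin
    sumTo d (λ k → powₛ (scaleₛ a g) k d * inv (fact k))
      ≈⟨ sumTo-cong d (λ k _ → trans (*-congʳ (powₛ-scaleₛ a g k d))
           (solve 3 (λ p q r → (p :* q) :* r := (p :* r) :* q) refl _ _ _)) ⟩
    sumTo d (λ k → (pow a k * inv (fact k)) * powₛ g k d)
      ≈⟨ sumTo-extend d≤N (λ k d<k _ → trans (*-congˡ (powₛ-vanish g0≈0 d<k)) (zeroʳ _)) ⟨
    sumTo N (λ k → (pow a k * inv (fact k)) * powₛ g k d) ∎

  *ₛ-expₛ-scaleₛ : ∀ (f : Series) a {g : Series} → g 0 ≈ 0# → ∀ n →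
    (f *ₛ expₛ (scaleₛ a g)) n ≈ sumTo n (λ k → (pow a k * inv (fact k)) * (f *ₛ powₛ g k) n)
  *ₛ-expₛ-scaleₛ f a {g} g0≈0 n = trans
    (*ₛ-congʳ-≤ n f (λ d d≤n → expₛ-scaleₛ a {g} g0≈0 d≤n))
    (*ₛ-sumʳ n (λ k → pow a k * inv (fact k)) f (powₛ g) n)

  ∂ₛ-*ₛ : ∀ (f g : Series) n → ∂ₛ (f *ₛ g) n ≈ (∂ₛ f *ₛ g) n + (f *ₛ ∂ₛ g) n
  ∂ₛ-*ₛ f g n = begin
    ι (suc n) * sumTo (suc n) (λ i → f i * g (suc n ∸ i))
      ≈⟨ *-distribˡ-sumTo (suc n) _ _ ⟩
    sumTo (suc n) (λ i → ι (suc n) * (f i * g (suc n ∸ i)))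
      ≈⟨ sumTo-cong (suc n) (λ i i≤1+n → trans (*-congʳ (sym (ι-split i≤1+n)))
           (solve 4 (λ p q u v → (p :+ q) :* (u :* v) := (p :* u) :* v :+ u :* (q :* v)) refl _ _ _ _)) ⟩
    sumTo (suc n) (λ i → (ι i * f i) * g (suc n ∸ i) + f i * (ι (suc n ∸ i) * g (suc n ∸ i)))
      ≈⟨ sumTo-+ (suc n) _ _ ⟩
    sumTo (suc n) (λ i → (ι i * f i) * g (suc n ∸ i)) + sumTo (suc n) (λ i → f i * (ι (suc n ∸ i) * g (suc n ∸ i)))
      ≈⟨ +-cong ∂f-part f∂-part ⟩
    (∂ₛ f *ₛ g) n + (f *ₛ ∂ₛ g) n ∎
    where
    ∂f-part : sumTo (suc n) (λ i → (ι i * f i) * g (suc n ∸ i)) ≈ (∂ₛ f *ₛ g) n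
    ∂f-part = trans (sumTo-suc n _)
      (trans (+-congʳ (trans (*-congʳ (zeroˡ (f 0))) (zeroˡ _))) (+-identityˡ _))
    f∂-part : sumTo (suc n) (λ i → f i * (ι (suc n ∸ i) * g (suc n ∸ i))) ≈ (f *ₛ ∂ₛ g) n
    f∂-part = trans
      (+-cong (sumTo-cong n (λ i i≤n → *-congˡ (reflexive (≡.cong (λ d → ι d * g d) (ℕ.+-∸-assoc 1 i≤n)))))
              (trans (*-congˡ (trans (*-congʳ (reflexive (≡.cong ι (ℕ.n∸n≡0 n)))) (zeroˡ _))) (zeroʳ _)))
      (+-identityʳ _)

  -- Falling factorials and binomial coefficients

  dfall-cong : ∀ lam {a b} → a ≈ b → ∀ n → dfall lam a n ≈ dfall lam b n
  dfall-cong lam a≈b zero = refl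
  dfall-cong lam a≈b (suc n) = *-cong (dfall-cong lam a≈b n) (+-congʳ a≈b)

  fall-suc-shift : ∀ x k → fall (1# + x) (suc k) ≈ (1# + x) * fall x k
  fall-suc-shift x zero = begin
    1# * ((1# + x) - 0# * 1#)  ≈⟨ *-identityˡ _ ⟩
    (1# + x) - 0# * 1#         ≈⟨ +-congˡ (trans (-‿cong (zeroˡ 1#)) -0#≈0#) ⟩
    (1# + x) + 0#              ≈⟨ +-identityʳ _ ⟩
    1# + x                     ≈⟨ *-identityʳ _ ⟨
    (1# + x) * 1#              ∎
  fall-suc-shift x (suc k) = begin
    fall (1# + x) (suc k) * ((1# + x) - (1# + ι k) * 1#)
      ≈⟨ *-cong (fall-suc-shift x k)
           (trans (+-congˡ (-‿cong (trans (distribʳ 1# 1# (ι k)) (+-congʳ (*-identityˡ 1#)))))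
                  (+-sub-+ 1# x (ι k * 1#))) ⟩
    ((1# + x) * fall x k) * (x - ι k * 1#)  ≈⟨ *-assoc _ _ _ ⟩
    (1# + x) * fall x (suc k)               ∎

  fall-ι-vanish : ∀ {j k} → j < k → fall (ι j) k ≈ 0#
  fall-ι-vanish {j} {suc k} (s≤s j≤k) with j ℕ.≟ k
  ... | yes ≡.refl = trans (*-congˡ (trans (+-congˡ (-‿cong (*-identityʳ (ι j)))) (-‿inverseʳ (ι j)))) (zeroʳ _)
  ... | no j≢k = trans (*-congʳ (fall-ι-vanish (ℕ.≤∧≢⇒< j≤k j≢k))) (zeroˡ _)

  fall-ι-diag : ∀ j → fall (ι j) j ≈ fact j
  fall-ι-diag zero = sym (+-identityʳ 1#)
  fall-ι-diag (suc j) = trans (fall-suc-shift (ι j) j) (trans (*-congˡ (fall-ι-diag j)) (sym (fact-suc j)))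

  fall-coefficients-vanish : ∀ n (d : ℕ → Carrier) →
    (∀ j → j ≤ n → sumTo n (λ k → d k * fall (ι j) k) ≈ 0#) → ∀ k → k ≤ n → d k ≈ 0#
  fall-coefficients-vanish n d sum≈0 = <-rec (λ k → k ≤ n → d k ≈ 0#) step
    where
    step : ∀ k → (∀ {i} → i < k → i ≤ n → d i ≈ 0#) → k ≤ n → d k ≈ 0#
    step k below k≤n = *-cancelˡ (fact≉0 k) (begin
      fact k * d k                        ≈⟨ *-comm _ _ ⟩
      d k * fact k                        ≈⟨ *-congˡ (fall-ι-diag k) ⟨
      d k * fall (ι k) k                  ≈⟨ sumTo-single k≤n off-diagonal ⟨
      sumTo n (λ i → d i * fall (ι k) i)  ≈⟨ sum≈0 k k≤n ⟩
      0#                                  ≈⟨ zeroʳ _ ⟨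
      fact k * 0#                         ∎)
      where
      off-diagonal : ∀ i → i ≤ n → i ≢ k → d i * fall (ι k) i ≈ 0#
      off-diagonal i i≤n i≢k with ℕ.<-cmp i k
      ... | tri< i<k _ _ = trans (*-congʳ (below i<k i≤n)) (zeroˡ _)
      ... | tri≈ _ i≡k _ = contradiction i≡k i≢k
      ... | tri> _ _ k<i = trans (*-congˡ (fall-ι-vanish k<i)) (zeroʳ _)

  fall-coefficients-unique : ∀ n (u v : ℕ → Carrier) →
    (∀ j → j ≤ n → sumTo n (λ k → u k * fall (ι j) k) ≈ sumTo n (λ k → v k * fall (ι j) k)) →
    ∀ k → k ≤ n → u k ≈ v k
  fall-coefficients-unique n u v agree k k≤n =
    x∙y⁻¹≈ε⇒x≈y (u k) (v k) (fall-coefficients-vanish n (λ k → u k - v k) difference k k≤n)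
    where
    difference : ∀ j → j ≤ n → sumTo n (λ k → (u k - v k) * fall (ι j) k) ≈ 0#
    difference j j≤n = begin
      sumTo n (λ k → (u k - v k) * fall (ι j) k)
        ≈⟨ sumTo-cong n (λ k _ → [y-z]x≈yx-zx _ _ _) ⟩
      sumTo n (λ k → u k * fall (ι j) k - v k * fall (ι j) k)
        ≈⟨ sumTo-sub n _ _ ⟩
      sumTo n (λ k → u k * fall (ι j) k) - sumTo n (λ k → v k * fall (ι j) k)
        ≈⟨ x≈y⇒x∙y⁻¹≈ε (agree j j≤n) ⟩
      0# ∎

  choose : ℕ → ℕ → Carrier
  choose j k = fall (ι j) k * inv (fact k)

  choose-zero : ∀ j → choose j 0 ≈ 1#
  choose-zero j = trans (*-identityˡ _) inv-fact-0

  choose-vanish : ∀ {j k} → j < k → choose j k ≈ 0#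
  choose-vanish j<k = trans (*-congʳ (fall-ι-vanish j<k)) (zeroˡ _)

  choose-pascal : ∀ j k → choose (suc j) (suc k) ≈ choose j k + choose j (suc k)
  choose-pascal j k = begin
    fall (1# + ι j) (suc k) * I
      ≈⟨ *-congʳ (fall-suc-shift (ι j) k) ⟩
    ((1# + ι j) * Fₖ) * I
      ≈⟨ *-congʳ (*-congʳ (trans (+-congˡ (sym (x+[y-x]≈y (ι k) (ι j)))) (sym (+-assoc _ _ _)))) ⟩
    (((1# + ι k) + (ι j - ι k)) * Fₖ) * I
      ≈⟨ solve 4 (λ u v f i → ((u :+ v) :* f) :* i := f :* (u :* i) :+ (f :* v) :* i) refl _ _ Fₖ I ⟩
    Fₖ * (ι (suc k) * I) + (Fₖ * (ι j - ι k)) * I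
      ≈⟨ +-cong (*-congˡ (ι[1+n]*inv-fact k)) (*-congʳ (*-congˡ (+-congˡ (-‿cong (sym (*-identityʳ (ι k))))))) ⟩
    choose j k + choose j (suc k) ∎
    where
    Fₖ = fall (ι j) k
    I = inv (fact (suc k))

  sumTo-choose-suc : ∀ {j N} → j ≤ N → (a : ℕ → Carrier) →
    sumTo (suc N) (λ k → choose (suc j) k * a k)
      ≈ sumTo N (λ k → choose j k * a k) + sumTo N (λ k → choose j k * a (suc k))
  sumTo-choose-suc {j} {N} j≤N a = begin
    sumTo (suc N) (λ k → choose (suc j) k * a k)
      ≈⟨ sumTo-suc N _ ⟩
    choose j 0 * a 0 + sumTo N (λ k → choose (suc j) (suc k) * a (suc k))
      ≈⟨ +-congˡ (sumTo-cong N (λ k _ → trans (*-congʳ (choose-pascal j k)) (distribʳ _ _ _))) ⟩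
    choose j 0 * a 0 + sumTo N (λ k → choose j k * a (suc k) + choose j (suc k) * a (suc k))
      ≈⟨ +-congˡ (sumTo-+ N _ _) ⟩
    choose j 0 * a 0 + (shifted + sumTo N (λ k → choose j (suc k) * a (suc k)))
      ≈⟨ solve 3 (λ x y z → x :+ (y :+ z) := (x :+ z) :+ y) refl _ shifted _ ⟩
    (choose j 0 * a 0 + sumTo N (λ k → choose j (suc k) * a (suc k))) + shifted
      ≈⟨ +-congʳ (sumTo-suc N _) ⟨
    sumTo (suc N) (λ k → choose j k * a k) + shifted
      ≈⟨ +-congʳ (trans (+-congˡ (trans (*-congʳ (choose-vanish (s≤s j≤N))) (zeroˡ _))) (+-identityʳ _)) ⟩
    sumTo N (λ k → choose j k * a k) + shifted ∎
    where
    shifted = sumTo N (λ k → choose j k * a (suc k))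

  powₛ-binomial : ∀ (g : Series) j {N} → j ≤ N →
    powₛ (oneₛ +ₛ g) j ≈ₛ (λ n → sumTo N (λ k → choose j k * powₛ g k n))
  powₛ-binomial g zero {N} _ n = sym (begin
    sumTo N (λ k → choose 0 k * powₛ g k n)
      ≈⟨ sumTo-extend {N = N} {f = λ k → choose 0 k * powₛ g k n} z≤n
           (λ k 0<k _ → trans (*-congʳ (choose-vanish 0<k)) (zeroˡ _)) ⟩
    choose 0 0 * oneₛ n  ≈⟨ *-congʳ (choose-zero 0) ⟩
    1# * oneₛ n          ≈⟨ *-identityˡ _ ⟩
    oneₛ n               ∎)
  powₛ-binomial g (suc j) {suc N} (s≤s j≤N) n = begin
    (powₛ (oneₛ +ₛ g) j *ₛ (oneₛ +ₛ g)) n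
      ≈⟨ *ₛ-congˡ (oneₛ +ₛ g) (powₛ-binomial g j j≤N) n ⟩
    (B *ₛ (oneₛ +ₛ g)) n
      ≈⟨ *ₛ-+ₛʳ B oneₛ g n ⟩
    (B *ₛ oneₛ) n + (B *ₛ g) n
      ≈⟨ +-cong (*ₛ-oneₛʳ B n) (*ₛ-sumˡ N (choose j) (powₛ g) g n) ⟩
    sumTo N (λ k → choose j k * powₛ g k n) + sumTo N (λ k → choose j k * powₛ g (suc k) n)
      ≈⟨ sumTo-choose-suc j≤N (λ k → powₛ g k n) ⟨
    sumTo (suc N) (λ k → choose (suc j) k * powₛ g k n) ∎
    where
    B : Series
    B t = sumTo N (λ k → choose j k * powₛ g k t)

  module DegenerateExponential (lam : Carrier) where

    eλ^-0 : ∀ a → eλ^ lam a 0 ≈ 1#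
    eλ^-0 a = trans (*-identityˡ _) inv-fact-0

    eλ^-cong : ∀ {a b} → a ≈ b → eλ^ lam a ≈ₛ eλ^ lam b
    eλ^-cong a≈b n = *-congʳ (dfall-cong lam a≈b n)

    fact-*-eλ^ : ∀ a n → fact n * eλ^ lam a n ≈ dfall lam a n
    fact-*-eλ^ a n = begin
      fact n * (dfall lam a n * inv (fact n))
        ≈⟨ solve 3 (λ f d i → f :* (d :* i) := d :* (f :* i)) refl _ _ _ ⟩
      dfall lam a n * (fact n * inv (fact n))  ≈⟨ *-congˡ (fact-inv n) ⟩
      dfall lam a n * 1#                       ≈⟨ *-identityʳ _ ⟩
      dfall lam a n                            ∎

    ∂ₛ-eλ^ : ∀ a n → ∂ₛ (eλ^ lam a) n ≈ (a - ι n * lam) * eλ^ lam a n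
    ∂ₛ-eλ^ a n = begin
      ι (suc n) * ((dfall lam a n * (a - ι n * lam)) * inv (fact (suc n)))
        ≈⟨ solve 4 (λ p d t i → p :* ((d :* t) :* i) := t :* (d :* (p :* i))) refl _ _ _ _ ⟩
      (a - ι n * lam) * (dfall lam a n * (ι (suc n) * inv (fact (suc n))))
        ≈⟨ *-congˡ (*-congˡ (ι[1+n]*inv-fact n)) ⟩
      (a - ι n * lam) * eλ^ lam a n ∎

    -- e_λ^a is the solution of the formal ODE (1 + λt) Q′ = a Q with Q(0) = 1.
    eλ^-unique : ∀ a (Q : Series) → Q 0 ≈ 1# → (∀ n → ∂ₛ Q n ≈ (a - ι n * lam) * Q n) →
      Q ≈ₛ eλ^ lam a
    eλ^-unique a Q Q₀ ∂Q zero = trans Q₀ (sym (eλ^-0 a))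
    eλ^-unique a Q Q₀ ∂Q (suc n) = *-cancelˡ (charZero n) (begin
      ∂ₛ Q n                         ≈⟨ ∂Q n ⟩
      (a - ι n * lam) * Q n          ≈⟨ *-congˡ (eλ^-unique a Q Q₀ ∂Q n) ⟩
      (a - ι n * lam) * eλ^ lam a n  ≈⟨ ∂ₛ-eλ^ a n ⟨
      ∂ₛ (eλ^ lam a) n               ∎)

    eλ^-zero : ∀ {a} → a ≈ 0# → oneₛ ≈ₛ eλ^ lam a
    eλ^-zero {a} a≈0 = eλ^-unique a oneₛ refl ∂oneₛ
      where
      ∂oneₛ : ∀ n → ∂ₛ oneₛ n ≈ (a - ι n * lam) * oneₛ n
      ∂oneₛ zero = trans (zeroʳ _) (sym (trans (*-identityʳ _)
        (trans (+-cong a≈0 (trans (-‿cong (zeroˡ lam)) -0#≈0#)) (+-identityʳ 0#))))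
      ∂oneₛ (suc n) = trans (zeroʳ _) (sym (zeroʳ _))

    eλ^-+ : ∀ a b → (eλ^ lam a *ₛ eλ^ lam b) ≈ₛ eλ^ lam (a + b)
    eλ^-+ a b = eλ^-unique (a + b) (A *ₛ B) (trans (*-cong (eλ^-0 a) (eλ^-0 b)) (*-identityˡ 1#)) ∂AB
      where
      A = eλ^ lam a
      B = eλ^ lam b
      term : ∀ n i → i ≤ n →
        ∂ₛ A i * B (n ∸ i) + A i * ∂ₛ B (n ∸ i) ≈ ((a + b) - ι n * lam) * (A i * B (n ∸ i))
      term n i i≤n = begin
        ∂ₛ A i * B (n ∸ i) + A i * ∂ₛ B (n ∸ i)
          ≈⟨ +-cong (*-congʳ (∂ₛ-eλ^ a i)) (*-congˡ (∂ₛ-eλ^ b (n ∸ i))) ⟩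
        ((a - ι i * lam) * A i) * B (n ∸ i) + A i * ((b - ι (n ∸ i) * lam) * B (n ∸ i))
          ≈⟨ solve 4 (λ p q u v → (p :* u) :* v :+ u :* (q :* v) := (p :+ q) :* (u :* v)) refl _ _ _ _ ⟩
        ((a - ι i * lam) + (b - ι (n ∸ i) * lam)) * (A i * B (n ∸ i))
          ≈⟨ *-congʳ (-‿interchange _ _ _ _) ⟩
        ((a + b) - (ι i * lam + ι (n ∸ i) * lam)) * (A i * B (n ∸ i))
          ≈⟨ *-congʳ (+-congˡ (-‿cong (trans (sym (distribʳ lam _ _)) (*-congʳ (ι-split i≤n))))) ⟩
        ((a + b) - ι n * lam) * (A i * B (n ∸ i)) ∎
      ∂AB : ∀ n → ∂ₛ (A *ₛ B) n ≈ ((a + b) - ι n * lam) * (A *ₛ B) n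
      ∂AB n = begin
        ∂ₛ (A *ₛ B) n
          ≈⟨ ∂ₛ-*ₛ A B n ⟩
        (∂ₛ A *ₛ B) n + (A *ₛ ∂ₛ B) n
          ≈⟨ sumTo-+ n _ _ ⟨
        sumTo n (λ i → ∂ₛ A i * B (n ∸ i) + A i * ∂ₛ B (n ∸ i))
          ≈⟨ sumTo-cong n (term n) ⟩
        sumTo n (λ i → ((a + b) - ι n * lam) * (A i * B (n ∸ i)))
          ≈⟨ *-distribˡ-sumTo n _ _ ⟨
        ((a + b) - ι n * lam) * (A *ₛ B) n ∎

    powₛ-eλ^ : ∀ a j → powₛ (eλ^ lam a) j ≈ₛ eλ^ lam (ι j * a)
    powₛ-eλ^ a zero = eλ^-zero (zeroˡ a)
    powₛ-eλ^ a (suc j) n = begin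
      (powₛ (eλ^ lam a) j *ₛ eλ^ lam a) n  ≈⟨ *ₛ-congˡ (eλ^ lam a) (powₛ-eλ^ a j) n ⟩
      (eλ^ lam (ι j * a) *ₛ eλ^ lam a) n   ≈⟨ eλ^-+ (ι j * a) a n ⟩
      eλ^ lam (ι j * a + a) n
        ≈⟨ eλ^-cong (solve 2 (λ i a → i :* a :+ a := (con 1 :+ i) :* a) refl (ι j) a) n ⟩
      eλ^ lam (ι (suc j) * a) n            ∎

  module DowlingGeneratingFunction (m : ℕ) (lam : Carrier) where
    open DegenerateExponential lam

    G : Series
    G = eλ^ lam (ι m) -ₛ oneₛ

    G-0 : G 0 ≈ 0#
    G-0 = trans (+-congʳ (eλ^-0 (ι m))) (-‿inverseʳ 1#)

    oneₛ+ₛG : (oneₛ +ₛ G) ≈ₛ eλ^ lam (ι m)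
    oneₛ+ₛG n = x+[y-x]≈y (oneₛ n) (eλ^ lam (ι m) n)

    S : ℕ → ℕ → Carrier
    S n k = (eλ lam *ₛ powₛ G k) n

    S-vanish : ∀ {n k} → n < k → S n k ≈ 0#
    S-vanish {n} {k} n<k = *ₛ-vanish (eλ lam) (powₛ G k) (λ d d≤n → powₛ-vanish {G} G-0 (ℕ.≤-<-trans d≤n n<k))

    falling-expansion : ∀ n j →
      sumTo n (λ k → (fact n * (inv (fact k) * S n k)) * fall (ι j) k) ≈ dfall lam (ι m * ι j + 1#) n
    falling-expansion n j = begin
      sumTo n (λ k → (fact n * (inv (fact k) * S n k)) * fall (ι j) k)
        ≈⟨ sumTo-cong n (λ k _ → solve 4 (λ f i s l → (f :* (i :* s)) :* l := f :* ((l :* i) :* s)) refl _ _ _ _) ⟩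
      sumTo n (λ k → fact n * (choose j k * S n k))
        ≈⟨ *-distribˡ-sumTo n _ _ ⟨
      fact n * sumTo n (λ k → choose j k * S n k)
        ≈⟨ *-congˡ (sumTo-extend (ℕ.m≤m+n n j) (λ k n<k _ → trans (*-congˡ (S-vanish n<k)) (zeroʳ _))) ⟨
      fact n * sumTo (n ℕ.+ j) (λ k → choose j k * S n k)
        ≈⟨ *-congˡ (*ₛ-sumʳ (n ℕ.+ j) (choose j) (eλ lam) (powₛ G) n) ⟨
      fact n * (eλ lam *ₛ (λ d → sumTo (n ℕ.+ j) (λ k → choose j k * powₛ G k d))) n
        ≈⟨ *-congˡ (*ₛ-congʳ (eλ lam)
             (λ d → trans (sym (powₛ-binomial G j (ℕ.m≤n+m j n) d)) (powₛ-cong oneₛ+ₛG j d)) n) ⟩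
      fact n * (eλ lam *ₛ powₛ (eλ^ lam (ι m)) j) n
        ≈⟨ *-congˡ (*ₛ-congʳ (eλ lam) (powₛ-eλ^ (ι m) j) n) ⟩
      fact n * (eλ lam *ₛ eλ^ lam (ι j * ι m)) n
        ≈⟨ *-congˡ (eλ^-+ 1# (ι j * ι m) n) ⟩
      fact n * eλ^ lam (1# + ι j * ι m) n
        ≈⟨ fact-*-eλ^ _ n ⟩
      dfall lam (1# + ι j * ι m) n
        ≈⟨ dfall-cong lam (trans (+-comm _ _) (+-congʳ (*-comm _ _))) n ⟩
      dfall lam (ι m * ι j + 1#) n ∎

    whitney-closed-form : ∀ W → IsDegWhitney2 m lam W → ∀ {n k} → k ≤ n →
      W n k * pow (ι m) k ≈ fact n * (inv (fact k) * S n k)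
    whitney-closed-form W isW {n} {k} k≤n =
      fall-coefficients-unique n (λ k → W n k * pow (ι m) k) (λ k → fact n * (inv (fact k) * S n k))
        (λ j _ → trans (sym (isW n (ι j))) (sym (falling-expansion n j))) k k≤n

    dowling-term : ∀ W → IsDegWhitney2 m lam W → ¬ ι m ≈ 0# → ∀ x {n k} → k ≤ n →
      (pow (x * inv (ι m)) k * inv (fact k)) * S n k ≈ (W n k * pow x k) * inv (fact n)
    dowling-term W isW ιm≉0 x {n} {k} k≤n = begin
      (pow (x * inv (ι m)) k * inv (fact k)) * S n k
        ≈⟨ *-congʳ (*-congʳ (pow-homo-* x (inv (ι m)) k)) ⟩
      ((X * P) * inv (fact k)) * S n k
        ≈⟨ *-identityʳ _ ⟨
      (((X * P) * inv (fact k)) * S n k) * 1#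
        ≈⟨ *-congˡ (fact-inv n) ⟨
      (((X * P) * inv (fact k)) * S n k) * (fact n * inv (fact n))
        ≈⟨ solve 6 (λ x p i s f j → (((x :* p) :* i) :* s) :* (f :* j) := ((x :* p) :* j) :* (f :* (i :* s)))
             refl X P _ _ _ _ ⟩
      ((X * P) * inv (fact n)) * (fact n * (inv (fact k) * S n k))
        ≈⟨ *-congˡ (whitney-closed-form W isW k≤n) ⟨
      ((X * P) * inv (fact n)) * (W n k * pow (ι m) k)
        ≈⟨ solve 5 (λ x p j w q → ((x :* p) :* j) :* (w :* q) := ((w :* x) :* j) :* (p :* q)) refl X P _ _ _ ⟩
      ((W n k * X) * inv (fact n)) * (P * pow (ι m) k)
        ≈⟨ *-congˡ (pow-inv ιm≉0 k) ⟩
      ((W n k * X) * inv (fact n)) * 1#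
        ≈⟨ *-identityʳ _ ⟩
      (W n k * X) * inv (fact n) ∎
      where
      X = pow x k
      P = pow (inv (ι m)) k

theorem3 : ∀ {c ℓ} (F : CharZeroField c ℓ) →
    let open CharZeroField F in
    let open FieldDefs F in
    (m : ℕ) → m ≥ 1 → (lam : Carrier) → ¬ (lam ≈ 0#) →
    (W : ℕ → ℕ → Carrier) → IsDegWhitney2 m lam W →
    (x : Carrier) →
    (eλ lam *ₛ expₛ (scaleₛ (x * inv (ι m)) (eλ^ lam (ι m) -ₛ oneₛ)))
      ≈ₛ (λ n → dowling W n x * inv (fact n))
theorem3 F (suc m) (s≤s z≤n) lam _ W isW x n = begin
  (eλ lam *ₛ expₛ (scaleₛ (x * inv (ι (suc m))) G)) n
    ≈⟨ *ₛ-expₛ-scaleₛ (eλ lam) (x * inv (ι (suc m))) G-0 n ⟩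
  sumTo n (λ k → (pow (x * inv (ι (suc m))) k * inv (fact k)) * S n k)
    ≈⟨ sumTo-cong n (λ k → dowling-term W isW (charZero m) x) ⟩
  sumTo n (λ k → (W n k * pow x k) * inv (fact n))
    ≈⟨ *-distribʳ-sumTo n _ _ ⟨
  dowling W n x * inv (fact n) ∎
  where
  open CharZeroField F hiding (zero)
  open FieldDefs F
  open Theory F
  open DowlingGeneratingFunction (suc m) lam
  open Relation.Binary.Reasoning.Setoid setoid
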